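{- Let $P\subset\mathbb{R}^n$ be a rational polytope. Then for every $i\in\{1,\dots,n\}$ such that the rational indices $\tilde{\mathrm{d}}_{i-1}(P)$ and $\tilde{\mathrm{d}}_i(P)$ exist, $\tilde{\mathrm{d}}_{i-1}(P)/\tilde{\mathrm{d}}_{i}(P)\in\mathbb{Z}$.
   Context: The rational $i$-index of a rational polytope $P$ is $\tilde{\mathrm{d}}_i(P)=\min\{r\in\mathbb{Q}_{>0}: r\,\mathrm{aff}(F)\cap\mathbb{Z}^n\neq\emptyset \text{ for all } i\text{ -dimensional faces } F \text{ of } P\}$, where $\mathrm{aff}$ denotes affine hull (when this minimum exists). -}

module Defs where

open import Data.Nat using (ℕ; zero; suc)
open import Data.Fin using (Fin; zero; suc)
open import Data.Integer using (ℤ)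
open import Data.Rational using (ℚ; 0ℚ; 1ℚ; _+_; _*_; _≤_; _<_; _/_)
open import Data.Product using (Σ; ∃; _×_; _,_)
open import Relation.Binary.PropositionalEquality using (_≡_)
open import Relation.Nullary using (¬_)

Point : ℕ → Set
Point n = Fin n → ℚ

ℤtoℚ : ℤ → ℚ
ℤtoℚ z = z / 1

∑ : ∀ {k} → (Fin k → ℚ) → ℚ
∑ {zero}  f = 0ℚ
∑ {suc k} f = f zero + ∑ (λ j → f (suc j))

dot : ∀ {n} → Point n → Point n → ℚ
dot x y = ∑ (λ t → x t * y t)

-- A rational polytope P = conv{V 0, …, V (m-1)} ⊂ ℝ^n is given by finitely many
-- rational points V : Fin m → Point n.
-- Its (nonempty) faces are F_c = argmax_{x ∈ P} ⟨c,x⟩ = conv{V j : j ∈ FaceVert V c},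
-- for (rational) linear functionals c.
FaceVert : ∀ {n m} → (Fin m → Point n) → Point n → Fin m → Set
FaceVert V c j = ∀ k → dot c (V k) ≤ dot c (V j)

InAff : ∀ {n m} → (Fin m → Point n) → (Fin m → Set) → Point n → Set
InAff {n} {m} V S x =
  Σ (Fin m → ℚ) λ λs →
    (∀ j → ¬ S j → λs j ≡ 0ℚ) ×
    (∑ λs ≡ 1ℚ) ×
    (∀ t → ∑ (λ j → λs j * V j t) ≡ x t)

AffIndep : ∀ {n k} → (Fin k → Point n) → Set
AffIndep {n} {k} p =
  ∀ (μ : Fin k → ℚ) → ∑ μ ≡ 0ℚ → (∀ t → ∑ (λ s → μ s * p s t) ≡ 0ℚ) →
    ∀ s → μ s ≡ 0ℚ

HasAffIndep : ∀ {n m} → (Fin m → Point n) → (Fin m → Set) → ℕ → Set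
HasAffIndep {n} {m} V S k =
  Σ (Fin k → Fin m) λ idx → (∀ s → S (idx s)) × AffIndep (λ s → V (idx s))

AffDim : ∀ {n m} → (Fin m → Point n) → (Fin m → Set) → ℕ → Set
AffDim V S i = HasAffIndep V S (suc i) × ¬ HasAffIndep V S (suc (suc i))

-- r · aff(F) ∩ ℤ^n ≠ ∅ for every i-dimensional face F of P = conv(V)
IndexCond : ∀ {n m} → (Fin m → Point n) → ℕ → ℚ → Set
IndexCond {n} V i r =
  ∀ (c : Point n) → AffDim V (FaceVert V c) i →
    Σ (Fin n → ℤ) λ z → Σ (Point n) λ y →
      InAff V (FaceVert V c) y × (∀ t → ℤtoℚ (z t) ≡ r * y t)

-- r is the rational i-index d̃_i(P) (the minimum exists and equals r)
IsRationalIndex : ∀ {n m} → (Fin m → Point n) → ℕ → ℚ → Set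
IsRationalIndex V i r =
  (0ℚ < r) × IndexCond V i r × (∀ s → 0ℚ < s → IndexCond V i s → r ≤ s)

module Submission where

-- Let F be an i-face of P. Growing a proper face of F one dimension at a time (adding a
-- vertex off its affine hull, or rotating the cutting functional about that hull) gives
-- an (i−1)-face G of F, which is also a face of P; as aff G ⊆ aff F, every dilation
-- factor that works for all (i−1)-faces works for all i-faces, in particular
-- r = d̃_{i−1}(P). For a fixed face, the factors t with t · aff F ∩ ℤⁿ ≠ ∅ are closed
-- under nonzero ℤ-linear combinations: if z = t y and z′ = t′ y′ with y, y′ ∈ aff F,
-- then a z + b z′ is (a t + b t′) times an affine combination of y and y′. Dividing r
-- by s = d̃_i(P) with remainder, r = k s + ρ with 0 ≤ ρ < s, the remainder ρ is again
-- admissible for all i-faces, so minimality of s forces ρ = 0.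

open import Defs
open import Data.Nat using (ℕ; suc; pred) renaming (_≤_ to _≤ℕ_)
open import Data.Fin using (Fin)
open import Data.Integer using (ℤ)
open import Data.Rational using (ℚ; _*_)
open import Data.Product using (Σ)
open import Relation.Binary.PropositionalEquality using (_≡_)

open import Level using (0ℓ)
open import Algebra.Bundles using (CommutativeRing)
import Data.Maybe.Base as Maybe
open import Data.Nat as ℕ using (zero; s≤s; z≤n)
import Data.Nat.Properties as ℕ
open import Data.Fin using (zero; suc; punchIn; punchOut)
import Data.Fin.Properties as Fin
import Data.Integer as ℤ
import Data.Integer.Properties as ℤ
import Data.Integer.DivMod as ℤ
open import Data.Rational as ℚ using (0ℚ; 1ℚ; _+_; _-_; -_; _≤_; _<_; ½; ↥_; ↧ₙ_; mkℚ)
import Data.Rational.Properties as ℚ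
import Data.Rational.Unnormalised as ℚᵘ
import Data.Rational.Unnormalised.Properties as ℚᵘ
open import Data.Product using (∃; _×_; _,_; proj₁; proj₂)
open import Data.Sum using (_⊎_; inj₁; inj₂; [_,_]′)
import Data.Sum as Sum
open import Data.Unit using (⊤; tt)
open import Data.Vec.Functional using (_∷_)
open import Function using (id)
open import Relation.Nullary using (¬_; yes; no; contradiction; ¬?)
open import Relation.Nullary.Decidable using (_×-dec_; _→-dec_; decidable-stable; dec⇒maybe)
open import Relation.Unary using (Decidable)
open import Relation.Binary using (tri<; tri≈; tri>)
open import Relation.Binary.PropositionalEquality
  using (_≢_; refl; sym; trans; cong; cong₂; subst; subst₂; ≢-sym; module ≡-Reasoning)
import Relation.Binary.Reasoning.Setoid as SetoidReasoning
open import Tactic.RingSolver using (solve-∀)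
import Tactic.RingSolver.Core.AlmostCommutativeRing as ACR
open import Algebra.Properties.Group ℚ.+-0-group using (x∙y⁻¹≈ε⇒x≈y; ⁻¹-involutive)
open import Algebra.Properties.Semiring.Sum (CommutativeRing.semiring ℚ.+-*-commutativeRing)
  using (sum; ∑-distrib-+; ∑-comm; sum-replicate-zero; *-distribˡ-sum)

ℚ-ring : ACR.AlmostCommutativeRing 0ℓ 0ℓ
ℚ-ring = ACR.fromCommutativeRing ℚ.+-*-commutativeRing
  (λ p → Maybe.map sym (dec⇒maybe (p ℚ.≟ 0ℚ)))

p-q≡0⇒p≡q : ∀ {p q} → p - q ≡ 0ℚ → p ≡ q
p-q≡0⇒p≡q = x∙y⁻¹≈ε⇒x≈y _ _

p≤q⇒0≤q-p : ∀ {p q} → p ≤ q → 0ℚ ≤ q - p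
p≤q⇒0≤q-p {p} {q} h = subst (_≤ q - p) (ℚ.+-inverseʳ p) (ℚ.+-monoˡ-≤ (- p) h)

p<q⇒0<q-p : ∀ {p q} → p < q → 0ℚ < q - p
p<q⇒0<q-p {p} {q} h = subst (_< q - p) (ℚ.+-inverseʳ p) (ℚ.+-monoˡ-< (- p) h)

p+[q-p]≡q : ∀ p q → p + (q - p) ≡ q
p+[q-p]≡q = solve-∀ ℚ-ring

0≤q-p⇒p≤q : ∀ {p q} → 0ℚ ≤ q - p → p ≤ q
0≤q-p⇒p≤q {p} {q} h = subst₂ _≤_ (ℚ.+-identityʳ p) (p+[q-p]≡q p q) (ℚ.+-monoʳ-≤ p h)

0<q-p⇒p<q : ∀ {p q} → 0ℚ < q - p → p < q
0<q-p⇒p<q {p} {q} h = subst₂ _<_ (ℚ.+-identityʳ p) (p+[q-p]≡q p q) (ℚ.+-monoʳ-< p h)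

0<p⇒p≢0 : ∀ {p} → 0ℚ < p → p ≢ 0ℚ
0<p⇒p≢0 h = ≢-sym (ℚ.<⇒≢ h)

*-pos : ∀ {p q} → 0ℚ < p → 0ℚ < q → 0ℚ < p * q
*-pos {p} {q} hp hq =
  ℚ.positive⁻¹ _ {{ℚ.pos*pos⇒pos p {{ℚ.positive hp}} q {{ℚ.positive hq}}}}

*-nonNeg : ∀ {p q} → 0ℚ ≤ p → 0ℚ ≤ q → 0ℚ ≤ p * q
*-nonNeg {p} {q} hp hq =
  ℚ.nonNegative⁻¹ _ {{ℚ.nonNeg*nonNeg⇒nonNeg p {{ℚ.nonNegative hp}} q {{ℚ.nonNegative hq}}}}

p*p≡-p*-p : ∀ p → p * p ≡ (- p) * (- p)
p*p≡-p*-p = solve-∀ ℚ-ring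

0≤p*p : ∀ p → 0ℚ ≤ p * p
0≤p*p p with ℚ.≤-total 0ℚ p
... | inj₁ 0≤p = *-nonNeg 0≤p 0≤p
... | inj₂ p≤0 = subst (0ℚ ≤_) (sym (p*p≡-p*-p p)) (*-nonNeg 0≤-p 0≤-p)
  where 0≤-p = ℚ.neg-antimono-≤ p≤0

p≢0⇒0<p*p : ∀ p → p ≢ 0ℚ → 0ℚ < p * p
p≢0⇒0<p*p p p≢0 with ℚ.<-cmp 0ℚ p
... | tri< 0<p _ _ = *-pos 0<p 0<p
... | tri≈ _ 0≡p _ = contradiction (sym 0≡p) p≢0
... | tri> _ _ p<0 = subst (0ℚ <_) (sym (p*p≡-p*-p p)) (*-pos 0<-p 0<-p)
  where 0<-p = ℚ.neg-antimono-< p<0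

infix 8 _⁻¹

-- The inverse, made total by the junk value 0⁻¹ = 0.
_⁻¹ : ℚ → ℚ
p ⁻¹ with p ℚ.≟ 0ℚ
... | yes _   = 0ℚ
... | no p≢0 = ℚ.1/_ p {{ℚ.≢-nonZero p≢0}}

p*p⁻¹≡1 : ∀ {p} → p ≢ 0ℚ → p * p ⁻¹ ≡ 1ℚ
p*p⁻¹≡1 {p} p≢0 with p ℚ.≟ 0ℚ
... | yes p≡0  = contradiction p≡0 p≢0
... | no p≢0′ = ℚ.*-inverseʳ p {{ℚ.≢-nonZero p≢0′}}

0<p⇒0<p⁻¹ : ∀ {p} → 0ℚ < p → 0ℚ < p ⁻¹
0<p⇒0<p⁻¹ {p} 0<p with p ℚ.≟ 0ℚ
... | yes p≡0  = contradiction p≡0 (0<p⇒p≢0 0<p)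
... | no p≢0 = ℚ.positive⁻¹ _ {{ℚ.1/pos⇒pos p {{ℚ.positive 0<p}}}}

p*q≡0⇒q≡0 : ∀ {p q} → p ≢ 0ℚ → p * q ≡ 0ℚ → q ≡ 0ℚ
p*q≡0⇒q≡0 {p} {q} p≢0 pq≡0 = begin
  q               ≡⟨ sym (ℚ.*-identityˡ q) ⟩
  1ℚ * q          ≡⟨ cong (_* q) (sym (p*p⁻¹≡1 p≢0)) ⟩
  (p * p ⁻¹) * q  ≡⟨ rearrange p (p ⁻¹) q ⟩
  p ⁻¹ * (p * q)  ≡⟨ cong (p ⁻¹ *_) pq≡0 ⟩
  p ⁻¹ * 0ℚ       ≡⟨ ℚ.*-zeroʳ (p ⁻¹) ⟩
  0ℚ              ∎
  where
  open ≡-Reasoning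
  rearrange : ∀ a b c → (a * b) * c ≡ b * (a * c)
  rearrange = solve-∀ ℚ-ring

<⇒≱ : ∀ {p q} → p < q → ¬ q ≤ p
<⇒≱ p<q q≤p = ℚ.<-irrefl refl (ℚ.<-≤-trans p<q q≤p)

0<1 : 0ℚ < 1ℚ
0<1 = ℚ.*<* (ℤ.+<+ (s≤s z≤n))

0<½ : 0ℚ < ½
0<½ = ℚ.*<* (ℤ.+<+ (s≤s z≤n))

p*½<p : ∀ {p} → 0ℚ < p → p * ½ < p
p*½<p {p} 0<p = 0<q-p⇒p<q (subst (0ℚ <_) (halve p) (*-pos 0<p 0<½))
  where
  halve : ∀ p → p * ½ ≡ p - p * ½
  halve = solve-∀ ℚ-ring

+-*-tight : ∀ {a A b B t} → a ≤ A → b ≤ B → 0ℚ < t → A + t * B ≤ a + t * b → A ≤ a × B ≤ b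
+-*-tight {a} {A} {b} {B} {t} a≤A b≤B 0<t A+tB≤a+tb =
  0≤q-p⇒p≤q (subst (0ℚ ≤_) (sym (split₁ a A b B t))
    (ℚ.+-mono-≤ D≥0 (*-nonNeg (ℚ.<⇒≤ 0<t) (p≤q⇒0≤q-p b≤B)))) ,
  0≤q-p⇒p≤q (ℚ.*-cancelˡ-≤-pos t {{ℚ.positive 0<t}}
    (subst₂ _≤_ (sym (ℚ.*-zeroʳ t)) (sym (split₂ a A b B t))
    (ℚ.+-mono-≤ D≥0 (p≤q⇒0≤q-p a≤A))))
  where
  D≥0 = p≤q⇒0≤q-p A+tB≤a+tb
  split₁ : ∀ a A b B t → a - A ≡ ((a + t * b) - (A + t * B)) + t * (B - b)
  split₁ = solve-∀ ℚ-ring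
  split₂ : ∀ a A b B t → t * (b - B) ≡ ((a + t * b) - (A + t * B)) + (A - a)
  split₂ = solve-∀ ℚ-ring

ℤtoℚ-toℚᵘ : ∀ z → ℚ.toℚᵘ (ℤtoℚ z) ℚᵘ.≃ ℚᵘ.mkℚᵘ z 0
ℤtoℚ-toℚᵘ z = ℚ.toℚᵘ-fromℚᵘ (ℚᵘ.mkℚᵘ z 0)

ℤtoℚ-+ : ∀ a b → ℤtoℚ (a ℤ.+ b) ≡ ℤtoℚ a + ℤtoℚ b
ℤtoℚ-+ a b = ℚ.toℚᵘ-injective (begin
  ℚ.toℚᵘ (ℤtoℚ (a ℤ.+ b))
    ≈⟨ ℤtoℚ-toℚᵘ (a ℤ.+ b) ⟩
  ℚᵘ.mkℚᵘ (a ℤ.+ b) 0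
    ≈⟨ ℚᵘ.*≡* (cong (ℤ._* ℤ.+ 1) (cong₂ ℤ._+_ (sym (ℤ.*-identityʳ a)) (sym (ℤ.*-identityʳ b)))) ⟩
  ℚᵘ.mkℚᵘ a 0 ℚᵘ.+ ℚᵘ.mkℚᵘ b 0
    ≈⟨ ℚᵘ.+-cong (ℤtoℚ-toℚᵘ a) (ℤtoℚ-toℚᵘ b) ⟨
  ℚ.toℚᵘ (ℤtoℚ a) ℚᵘ.+ ℚ.toℚᵘ (ℤtoℚ b)
    ≈⟨ ℚ.toℚᵘ-homo-+ (ℤtoℚ a) (ℤtoℚ b) ⟨
  ℚ.toℚᵘ (ℤtoℚ a + ℤtoℚ b) ∎)
  where open SetoidReasoning ℚᵘ.≃-setoid

ℤtoℚ-* : ∀ a b → ℤtoℚ (a ℤ.* b) ≡ ℤtoℚ a * ℤtoℚ b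
ℤtoℚ-* a b = ℚ.toℚᵘ-injective (begin
  ℚ.toℚᵘ (ℤtoℚ (a ℤ.* b))                    ≈⟨ ℤtoℚ-toℚᵘ (a ℤ.* b) ⟩
  ℚᵘ.mkℚᵘ (a ℤ.* b) 0                         ≈⟨ ℚᵘ.*≡* refl ⟩
  ℚᵘ.mkℚᵘ a 0 ℚᵘ.* ℚᵘ.mkℚᵘ b 0                ≈⟨ ℚᵘ.*-cong (ℤtoℚ-toℚᵘ a) (ℤtoℚ-toℚᵘ b) ⟨
  ℚ.toℚᵘ (ℤtoℚ a) ℚᵘ.* ℚ.toℚᵘ (ℤtoℚ b)        ≈⟨ ℚ.toℚᵘ-homo-* (ℤtoℚ a) (ℤtoℚ b) ⟨
  ℚ.toℚᵘ (ℤtoℚ a * ℤtoℚ b)                    ∎)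
  where open SetoidReasoning ℚᵘ.≃-setoid

ℤtoℚ-neg : ∀ a → ℤtoℚ (ℤ.- a) ≡ - ℤtoℚ a
ℤtoℚ-neg a = ℚ.toℚᵘ-injective (begin
  ℚ.toℚᵘ (ℤtoℚ (ℤ.- a))      ≈⟨ ℤtoℚ-toℚᵘ (ℤ.- a) ⟩
  ℚᵘ.mkℚᵘ (ℤ.- a) 0          ≈⟨ ℚᵘ.-‿cong (ℤtoℚ-toℚᵘ a) ⟨
  ℚᵘ.- ℚ.toℚᵘ (ℤtoℚ a)       ≈⟨ ℚ.toℚᵘ-homo‿- (ℤtoℚ a) ⟨
  ℚ.toℚᵘ (- ℤtoℚ a)          ∎)
  where open SetoidReasoning ℚᵘ.≃-setoid

ℤtoℚ-mono-< : ∀ {a b} → a ℤ.< b → ℤtoℚ a < ℤtoℚ b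
ℤtoℚ-mono-< {a} {b} a<b = ℚ.toℚᵘ-cancel-< (begin-strict
  ℚ.toℚᵘ (ℤtoℚ a)   ≃⟨ ℤtoℚ-toℚᵘ a ⟩
  ℚᵘ.mkℚᵘ a 0        <⟨ ℚᵘ.*<* (subst₂ ℤ._<_ (sym (ℤ.*-identityʳ a)) (sym (ℤ.*-identityʳ b)) a<b) ⟩
  ℚᵘ.mkℚᵘ b 0        ≃⟨ ℤtoℚ-toℚᵘ b ⟨
  ℚ.toℚᵘ (ℤtoℚ b)   ∎)
  where open ℚᵘ.≤-Reasoning

ℤtoℚ-mono-≤ : ∀ {a b} → a ℤ.≤ b → ℤtoℚ a ≤ ℤtoℚ b
ℤtoℚ-mono-≤ {a} {b} a≤b = ℚ.toℚᵘ-cancel-≤ (begin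
  ℚ.toℚᵘ (ℤtoℚ a)   ≃⟨ ℤtoℚ-toℚᵘ a ⟩
  ℚᵘ.mkℚᵘ a 0        ≤⟨ ℚᵘ.*≤* (subst₂ ℤ._≤_ (sym (ℤ.*-identityʳ a)) (sym (ℤ.*-identityʳ b)) a≤b) ⟩
  ℚᵘ.mkℚᵘ b 0        ≃⟨ ℤtoℚ-toℚᵘ b ⟨
  ℚ.toℚᵘ (ℤtoℚ b)   ∎)
  where open ℚᵘ.≤-Reasoning

p*↧p≡↥p : ∀ p → p * ℤtoℚ (ℤ.+ ↧ₙ p) ≡ ℤtoℚ (↥ p)
p*↧p≡↥p p@(mkℚ a d-1 _) = ℚ.toℚᵘ-injective (begin
  ℚ.toℚᵘ (p * ℤtoℚ (ℤ.+ d))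
    ≈⟨ ℚ.toℚᵘ-homo-* p (ℤtoℚ (ℤ.+ d)) ⟩
  ℚᵘ.mkℚᵘ a d-1 ℚᵘ.* ℚ.toℚᵘ (ℤtoℚ (ℤ.+ d))
    ≈⟨ ℚᵘ.*-congˡ {ℚᵘ.mkℚᵘ a d-1} (ℤtoℚ-toℚᵘ (ℤ.+ d)) ⟩
  ℚᵘ.mkℚᵘ a d-1 ℚᵘ.* ℚᵘ.mkℚᵘ (ℤ.+ d) 0
    ≈⟨ ℚᵘ.*≡* (trans (ℤ.*-identityʳ _) (cong (λ k → a ℤ.* ℤ.+ suc k) (sym (ℕ.*-identityʳ d-1)))) ⟩
  ℚᵘ.mkℚᵘ a 0
    ≈⟨ ℤtoℚ-toℚᵘ a ⟨
  ℚ.toℚᵘ (ℤtoℚ a) ∎)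
  where
  d = suc d-1
  open SetoidReasoning ℚᵘ.≃-setoid

integer-part : ∀ x → Σ ℤ λ k → 0ℚ ≤ x - ℤtoℚ k × x - ℤtoℚ k < 1ℚ
integer-part x = k , cancel-≤ (subst₂ _≤_ (sym (ℚ.*-zeroʳ D)) (sym scaled) 0≤ρ)
                   , cancel-< (subst₂ _<_ (sym scaled) (sym (ℚ.*-identityʳ D)) ρ<D)
  where
  d = ↧ₙ x
  k = ↥ x ℤ./ℕ d
  ρ = ↥ x ℤ.%ℕ d
  D = ℤtoℚ (ℤ.+ d)
  0<D : 0ℚ < D
  0<D = ℤtoℚ-mono-< {ℤ.+ 0} {ℤ.+ d} (ℤ.+<+ (s≤s z≤n))
  0≤ρ : 0ℚ ≤ ℤtoℚ (ℤ.+ ρ)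
  0≤ρ = ℤtoℚ-mono-≤ {ℤ.+ 0} {ℤ.+ ρ} (ℤ.+≤+ z≤n)
  ρ<D : ℤtoℚ (ℤ.+ ρ) < D
  ρ<D = ℤtoℚ-mono-< {ℤ.+ ρ} {ℤ.+ d} (ℤ.+<+ (ℤ.n%ℕd<d (↥ x) d))
  cancel-≤ = ℚ.*-cancelˡ-≤-pos D {{ℚ.positive 0<D}}
  cancel-< = ℚ.*-cancelˡ-<-nonNeg D {{ℚ.nonNegative (ℚ.<⇒≤ 0<D)}}
  distribute : ∀ D x k → D * (x - k) ≡ x * D - k * D
  distribute = solve-∀ ℚ-ring
  cancel : ∀ ρ m → (ρ + m) - m ≡ ρ
  cancel = solve-∀ ℚ-ring
  scaled : D * (x - ℤtoℚ k) ≡ ℤtoℚ (ℤ.+ ρ)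
  scaled = begin
    D * (x - ℤtoℚ k)
      ≡⟨ distribute D x (ℤtoℚ k) ⟩
    x * D - ℤtoℚ k * D
      ≡⟨ cong₂ _-_ (p*↧p≡↥p x) (sym (ℤtoℚ-* k (ℤ.+ d))) ⟩
    ℤtoℚ (↥ x) - ℤtoℚ (k ℤ.* ℤ.+ d)
      ≡⟨ cong (λ n → ℤtoℚ n - ℤtoℚ (k ℤ.* ℤ.+ d)) (ℤ.a≡a%ℕn+[a/ℕn]*n (↥ x) d) ⟩
    ℤtoℚ (ℤ.+ ρ ℤ.+ k ℤ.* ℤ.+ d) - ℤtoℚ (k ℤ.* ℤ.+ d)
      ≡⟨ cong (_- ℤtoℚ (k ℤ.* ℤ.+ d)) (ℤtoℚ-+ (ℤ.+ ρ) (k ℤ.* ℤ.+ d)) ⟩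
    (ℤtoℚ (ℤ.+ ρ) + ℤtoℚ (k ℤ.* ℤ.+ d)) - ℤtoℚ (k ℤ.* ℤ.+ d)
      ≡⟨ cancel (ℤtoℚ (ℤ.+ ρ)) (ℤtoℚ (k ℤ.* ℤ.+ d)) ⟩
    ℤtoℚ (ℤ.+ ρ) ∎
    where open ≡-Reasoning

[p*q⁻¹-k]*q≡p-k*q : ∀ p {q} k → q ≢ 0ℚ → (p * q ⁻¹ - k) * q ≡ p - k * q
[p*q⁻¹-k]*q≡p-k*q p {q} k q≢0 = begin
  (p * q ⁻¹ - k) * q       ≡⟨ expand p (q ⁻¹) q k ⟩
  p * (q * q ⁻¹) - k * q   ≡⟨ cong (λ u → p * u - k * q) (p*p⁻¹≡1 q≢0) ⟩
  p * 1ℚ - k * q           ≡⟨ cong (_- k * q) (ℚ.*-identityʳ p) ⟩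
  p - k * q                ∎
  where
  open ≡-Reasoning
  expand : ∀ p i q k → (p * i - k) * q ≡ p * (q * i) - k * q
  expand = solve-∀ ℚ-ring

division-with-remainder : ∀ r {s} → 0ℚ < s →
  Σ ℤ λ k → 0ℚ ≤ r - ℤtoℚ k * s × r - ℤtoℚ k * s < s
division-with-remainder r {s} 0<s =
  k , subst (0ℚ ≤_) rescale (*-nonNeg 0≤frac (ℚ.<⇒≤ 0<s))
    , subst₂ _<_ rescale (ℚ.*-identityˡ s) (ℚ.*-monoˡ-<-pos s {{ℚ.positive 0<s}} frac<1)
  where
  k = proj₁ (integer-part (r * s ⁻¹))
  0≤frac = proj₁ (proj₂ (integer-part (r * s ⁻¹)))
  frac<1 = proj₂ (proj₂ (integer-part (r * s ⁻¹)))
  rescale = [p*q⁻¹-k]*q≡p-k*q r (ℤtoℚ k) (0<p⇒p≢0 0<s)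

∑≡sum : ∀ {k} (f : Fin k → ℚ) → ∑ f ≡ sum f
∑≡sum {zero}  f = refl
∑≡sum {suc k} f = cong (f zero +_) (∑≡sum (λ j → f (suc j)))

∑-cong : ∀ {k} {f g : Fin k → ℚ} → (∀ j → f j ≡ g j) → ∑ f ≡ ∑ g
∑-cong {zero}  f≗g = refl
∑-cong {suc k} f≗g = cong₂ _+_ (f≗g zero) (∑-cong (λ j → f≗g (suc j)))

∑-zero : ∀ {k} {f : Fin k → ℚ} → (∀ j → f j ≡ 0ℚ) → ∑ f ≡ 0ℚ
∑-zero {k} f≗0 = trans (∑-cong f≗0) (trans (∑≡sum {k} (λ _ → 0ℚ)) (sum-replicate-zero k))

∑-+ : ∀ {k} (f g : Fin k → ℚ) → ∑ (λ j → f j + g j) ≡ ∑ f + ∑ g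
∑-+ f g = begin
  ∑ (λ j → f j + g j)  ≡⟨ ∑≡sum (λ j → f j + g j) ⟩
  sum (λ j → f j + g j) ≡⟨ ∑-distrib-+ f g ⟩
  sum f + sum g        ≡⟨ cong₂ _+_ (∑≡sum f) (∑≡sum g) ⟨
  ∑ f + ∑ g            ∎
  where open ≡-Reasoning

∑-*ˡ : ∀ {k} a (f : Fin k → ℚ) → ∑ (λ j → a * f j) ≡ a * ∑ f
∑-*ˡ a f = begin
  ∑ (λ j → a * f j)    ≡⟨ ∑≡sum (λ j → a * f j) ⟩
  sum (λ j → a * f j)  ≡⟨ *-distribˡ-sum a f ⟨
  a * sum f            ≡⟨ cong (a *_) (∑≡sum f) ⟨
  a * ∑ f              ∎
  where open ≡-Reasoning

∑-*ʳ : ∀ {k} a (f : Fin k → ℚ) → ∑ (λ j → f j * a) ≡ ∑ f * a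
∑-*ʳ a f = begin
  ∑ (λ j → f j * a)  ≡⟨ ∑-cong (λ j → ℚ.*-comm (f j) a) ⟩
  ∑ (λ j → a * f j)  ≡⟨ ∑-*ˡ a f ⟩
  a * ∑ f            ≡⟨ ℚ.*-comm a (∑ f) ⟩
  ∑ f * a            ∎
  where open ≡-Reasoning

∑-swap : ∀ {k l} (f : Fin k → Fin l → ℚ) →
  ∑ (λ j → ∑ (λ t → f j t)) ≡ ∑ (λ t → ∑ (λ j → f j t))
∑-swap f = begin
  ∑ (λ j → ∑ (f j))
    ≡⟨ trans (∑-cong (λ j → ∑≡sum (f j))) (∑≡sum (λ j → sum (f j))) ⟩
  sum (λ j → sum (f j))
    ≡⟨ ∑-comm f ⟩
  sum (λ t → sum (λ j → f j t))
    ≡⟨ trans (∑-cong (λ t → ∑≡sum (λ j → f j t))) (∑≡sum (λ t → sum (λ j → f j t))) ⟨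
  ∑ (λ t → ∑ (λ j → f j t)) ∎
  where open ≡-Reasoning

∑-neg : ∀ {k} (f : Fin k → ℚ) → ∑ (λ j → - f j) ≡ - ∑ f
∑-neg {zero}  f = refl
∑-neg {suc k} f = trans (cong (- f zero +_) (∑-neg (λ j → f (suc j))))
                        (sym (ℚ.neg-distrib-+ (f zero) _))

∑-- : ∀ {k} (f g : Fin k → ℚ) → ∑ (λ j → f j - g j) ≡ ∑ f - ∑ g
∑-- f g = trans (∑-+ f (λ j → - g j)) (cong (∑ f +_) (∑-neg g))

∑-single : ∀ {k} (i : Fin k) (f : Fin k → ℚ) → (∀ j → j ≢ i → f j ≡ 0ℚ) → ∑ f ≡ f i
∑-single {suc k} zero    f vanish =
  trans (cong (f zero +_) (∑-zero (λ j → vanish (suc j) (λ ())))) (ℚ.+-identityʳ _)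
∑-single {suc k} (suc i) f vanish =
  trans (cong (_+ ∑ (λ j → f (suc j))) (vanish zero (λ ())))
        (trans (ℚ.+-identityˡ _)
               (∑-single i (λ j → f (suc j))
                 (λ j j≢i → vanish (suc j) (λ sj≡si → j≢i (Fin.suc-injective sj≡si)))))

∑-nonNeg : ∀ {k} (f : Fin k → ℚ) → (∀ j → 0ℚ ≤ f j) → 0ℚ ≤ ∑ f
∑-nonNeg {zero}  f 0≤f = ℚ.≤-refl
∑-nonNeg {suc k} f 0≤f = ℚ.+-mono-≤ (0≤f zero) (∑-nonNeg (λ j → f (suc j)) (λ j → 0≤f (suc j)))

∑-pos : ∀ {k} (f : Fin k → ℚ) → (∀ j → 0ℚ ≤ f j) → (i : Fin k) → 0ℚ < f i → 0ℚ < ∑ f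
∑-pos {suc k} f 0≤f zero    0<fi = ℚ.+-mono-<-≤ 0<fi (∑-nonNeg (λ j → f (suc j)) (λ j → 0≤f (suc j)))
∑-pos {suc k} f 0≤f (suc i) 0<fi =
  ℚ.+-mono-≤-< (0≤f zero) (∑-pos (λ j → f (suc j)) (λ j → 0≤f (suc j)) i 0<fi)

∑-negˡ : ∀ {k} (y f : Fin k → ℚ) → ∑ (λ l → (- y l) * f l) ≡ - ∑ (λ l → y l * f l)
∑-negˡ y f = trans (∑-cong (λ l → sym (ℚ.neg-distribˡ-* (y l) (f l)))) (∑-neg (λ l → y l * f l))

module _ {n : ℕ} where

  infixl 6 _+ᵥ_ _-ᵥ_
  infixr 7 _*ᵥ_

  _+ᵥ_ : Point n → Point n → Point n
  (x +ᵥ y) t = x t + y t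

  _-ᵥ_ : Point n → Point n → Point n
  (x -ᵥ y) t = x t - y t

  _*ᵥ_ : ℚ → Point n → Point n
  (a *ᵥ x) t = a * x t

combination : ∀ {n k} → (Fin k → ℚ) → (Fin k → Point n) → Point n
combination μ u t = ∑ (λ s → μ s * u s t)

basis : ∀ {n} → Fin n → Point n
basis i t with t Fin.≟ i
... | yes _ = 1ℚ
... | no  _ = 0ℚ

basis-self : ∀ {n} (i : Fin n) → basis i i ≡ 1ℚ
basis-self i with i Fin.≟ i
... | yes _   = refl
... | no  i≢i = contradiction refl i≢i

∑-basis : ∀ {n} (i : Fin n) (f : Fin n → ℚ) → ∑ (λ t → basis i t * f t) ≡ f i
∑-basis i f = begin
  ∑ (λ t → basis i t * f t)  ≡⟨ ∑-single i (λ t → basis i t * f t) off-diagonal ⟩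
  basis i i * f i            ≡⟨ cong (_* f i) (basis-self i) ⟩
  1ℚ * f i                   ≡⟨ ℚ.*-identityˡ (f i) ⟩
  f i                        ∎
  where
  open ≡-Reasoning
  off-diagonal : ∀ t → t ≢ i → basis i t * f t ≡ 0ℚ
  off-diagonal t t≢i with t Fin.≟ i
  ... | yes t≡i = contradiction t≡i t≢i
  ... | no  _   = ℚ.*-zeroˡ (f t)

module _ {n : ℕ} where

  dot-comm : (x y : Point n) → dot x y ≡ dot y x
  dot-comm x y = ∑-cong (λ t → ℚ.*-comm (x t) (y t))

  dot-congʳ : (z : Point n) {x y : Point n} → (∀ t → x t ≡ y t) → dot z x ≡ dot z y
  dot-congʳ z x≗y = ∑-cong (λ t → cong (z t *_) (x≗y t))

  dot-zeroʳ : (z : Point n) {x : Point n} → (∀ t → x t ≡ 0ℚ) → dot z x ≡ 0ℚ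
  dot-zeroʳ z {x} x≗0 = ∑-zero (λ t → trans (cong (z t *_) (x≗0 t)) (ℚ.*-zeroʳ (z t)))

  dot-+ᵥˡ : (x y z : Point n) → dot (x +ᵥ y) z ≡ dot x z + dot y z
  dot-+ᵥˡ x y z = trans (∑-cong (λ t → ℚ.*-distribʳ-+ (z t) (x t) (y t)))
                        (∑-+ (λ t → x t * z t) (λ t → y t * z t))

  dot--ᵥʳ : (z x y : Point n) → dot z (x -ᵥ y) ≡ dot z x - dot z y
  dot--ᵥʳ z x y = trans (∑-cong (λ t → distrib (z t) (x t) (y t)))
                        (∑-- (λ t → z t * x t) (λ t → z t * y t))
    where
    distrib : ∀ a b c → a * (b - c) ≡ a * b - a * c
    distrib = solve-∀ ℚ-ring

  dot--ᵥˡ : (x y z : Point n) → dot (x -ᵥ y) z ≡ dot x z - dot y z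
  dot--ᵥˡ x y z = trans (dot-comm _ z) (trans (dot--ᵥʳ z x y) (cong₂ _-_ (dot-comm z x) (dot-comm z y)))

  dot-*ᵥˡ : (a : ℚ) (x z : Point n) → dot (a *ᵥ x) z ≡ a * dot x z
  dot-*ᵥˡ a x z = trans (∑-cong (λ t → ℚ.*-assoc a (x t) (z t))) (∑-*ˡ a (λ t → x t * z t))

  dot-*ᵥʳ : (a : ℚ) (z x : Point n) → dot z (a *ᵥ x) ≡ a * dot z x
  dot-*ᵥʳ a z x = trans (dot-comm z _) (trans (dot-*ᵥˡ a x z) (cong (a *_) (dot-comm x z)))

  dot-combinationʳ : ∀ {k} (h : Point n) (μ : Fin k → ℚ) (u : Fin k → Point n) →
    dot h (combination μ u) ≡ ∑ (λ s → μ s * dot h (u s))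
  dot-combinationʳ h μ u = begin
    ∑ (λ t → h t * ∑ (λ s → μ s * u s t))
      ≡⟨ ∑-cong (λ t → ∑-*ˡ (h t) (λ s → μ s * u s t)) ⟨
    ∑ (λ t → ∑ (λ s → h t * (μ s * u s t)))
      ≡⟨ ∑-swap (λ t s → h t * (μ s * u s t)) ⟩
    ∑ (λ s → ∑ (λ t → h t * (μ s * u s t)))
      ≡⟨ ∑-cong (λ s → ∑-cong (λ t → exchange (h t) (μ s) (u s t))) ⟩
    ∑ (λ s → ∑ (λ t → μ s * (h t * u s t)))
      ≡⟨ ∑-cong (λ s → ∑-*ˡ (μ s) (λ t → h t * u s t)) ⟩
    ∑ (λ s → μ s * dot h (u s)) ∎
    where
    open ≡-Reasoning
    exchange : ∀ a b c → a * (b * c) ≡ b * (a * c)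
    exchange = solve-∀ ℚ-ring

  dot-combinationˡ : ∀ {k} (μ : Fin k → ℚ) (u : Fin k → Point n) (h : Point n) →
    dot (combination μ u) h ≡ ∑ (λ s → μ s * dot (u s) h)
  dot-combinationˡ μ u h = trans (dot-comm _ h)
    (trans (dot-combinationʳ h μ u) (∑-cong (λ s → cong (μ s *_) (dot-comm h (u s)))))

  dot-self-pos : (x : Point n) → ¬ (∀ t → x t ≡ 0ℚ) → 0ℚ < dot x x
  dot-self-pos x x≢0 with Fin.¬∀⟶∃¬ n _ (λ t → x t ℚ.≟ 0ℚ) x≢0
  ... | t , xt≢0 = ∑-pos (λ t → x t * x t) (λ t → 0≤p*p (x t)) t (p≢0⇒0<p*p (x t) xt≢0)

dot-tilted : ∀ {n} (d e x : Point n) t → dot (d +ᵥ t *ᵥ e) x ≡ dot d x + t * dot e x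
dot-tilted d e x t = trans (dot-+ᵥˡ d (t *ᵥ e) x) (cong (dot d x +_) (dot-*ᵥˡ t e x))

AffIndep-∷ : ∀ {n k} (q : Fin k → Point n) (w h : Point n) (M : ℚ) → AffIndep q →
  (∀ s → dot h (q s) ≡ M) → dot h w ≢ M → AffIndep (w ∷ q)
AffIndep-∷ q w h M q-indep hq≡M hw≢M μ ∑μ≡0 μ-vanishes = μ≡0
  where
  μ₀ = μ zero
  μ₊ : Fin _ → ℚ
  μ₊ s = μ (suc s)
  ∑μ₊≡-μ₀ : ∑ μ₊ ≡ - μ₀
  ∑μ₊≡-μ₀ = p-q≡0⇒p≡q (trans (rearrange μ₀ (∑ μ₊)) ∑μ≡0)
    where
    rearrange : ∀ a b → b - - a ≡ a + b
    rearrange = solve-∀ ℚ-ring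
  [hw-M]μ₀≡0 : (dot h w - M) * μ₀ ≡ 0ℚ
  [hw-M]μ₀≡0 = begin
    (dot h w - M) * μ₀
      ≡⟨ expand (dot h w) M μ₀ ⟩
    μ₀ * dot h w + (- μ₀) * M
      ≡⟨ cong (λ c → μ₀ * dot h w + c * M) ∑μ₊≡-μ₀ ⟨
    μ₀ * dot h w + ∑ μ₊ * M
      ≡⟨ cong (μ₀ * dot h w +_) (∑-*ʳ M μ₊) ⟨
    μ₀ * dot h w + ∑ (λ s → μ₊ s * M)
      ≡⟨ cong (μ₀ * dot h w +_) (∑-cong (λ s → cong (μ₊ s *_) (hq≡M s))) ⟨
    μ₀ * dot h w + ∑ (λ s → μ₊ s * dot h (q s))
      ≡⟨ dot-combinationʳ h μ (w ∷ q) ⟨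
    dot h (combination μ (w ∷ q))
      ≡⟨ dot-zeroʳ h μ-vanishes ⟩
    0ℚ ∎
    where
    open ≡-Reasoning
    expand : ∀ x M μ₀ → (x - M) * μ₀ ≡ μ₀ * x + (- μ₀) * M
    expand = solve-∀ ℚ-ring
  μ₀≡0 : μ₀ ≡ 0ℚ
  μ₀≡0 = p*q≡0⇒q≡0 (λ hw-M≡0 → hw≢M (p-q≡0⇒p≡q hw-M≡0)) [hw-M]μ₀≡0
  μ₊-vanishes : ∀ t → combination μ₊ q t ≡ 0ℚ
  μ₊-vanishes t = begin
    combination μ₊ q t
      ≡⟨ ℚ.+-identityˡ _ ⟨
    0ℚ + combination μ₊ q t
      ≡⟨ cong (_+ combination μ₊ q t) (trans (cong (_* w t) μ₀≡0) (ℚ.*-zeroˡ (w t))) ⟨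
    μ₀ * w t + combination μ₊ q t
      ≡⟨ μ-vanishes t ⟩
    0ℚ ∎
    where open ≡-Reasoning
  μ≡0 : ∀ s → μ s ≡ 0ℚ
  μ≡0 zero    = μ₀≡0
  μ≡0 (suc s) = q-indep μ₊ (trans ∑μ₊≡-μ₀ (cong -_ μ₀≡0)) μ₊-vanishes s

LinIndep : ∀ {n k} → (Fin k → Point n) → Set
LinIndep u = ∀ y → (∀ t → combination y u t ≡ 0ℚ) → ∀ l → y l ≡ 0ℚ

differences : ∀ {n k} → (Fin (suc k) → Point n) → Fin k → Point n
differences p l = p (suc l) -ᵥ p zero

AffIndep⇒LinIndep-differences : ∀ {n k} (p : Fin (suc k) → Point n) →
  AffIndep p → LinIndep (differences p)
AffIndep⇒LinIndep-differences p p-indep y y-vanishes l =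
  p-indep ((- ∑ y) ∷ y) (ℚ.+-inverseˡ (∑ y)) vanishes (suc l)
  where
  vanishes : ∀ t → (- ∑ y) * p zero t + combination y (λ l → p (suc l)) t ≡ 0ℚ
  vanishes t = begin
    (- ∑ y) * p zero t + combination y (λ l → p (suc l)) t
      ≡⟨ rearrange (∑ y) (p zero t) _ ⟩
    combination y (λ l → p (suc l)) t - ∑ y * p zero t
      ≡⟨ cong (λ c → combination y (λ l → p (suc l)) t - c) (∑-*ʳ (p zero t) y) ⟨
    combination y (λ l → p (suc l)) t - ∑ (λ l → y l * p zero t)
      ≡⟨ ∑-- (λ l → y l * p (suc l) t) (λ l → y l * p zero t) ⟨
    ∑ (λ l → y l * p (suc l) t - y l * p zero t)
      ≡⟨ ∑-cong (λ l → distrib (y l) (p (suc l) t) (p zero t)) ⟩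
    combination y (differences p) t
      ≡⟨ y-vanishes t ⟩
    0ℚ ∎
    where
    open ≡-Reasoning
    rearrange : ∀ s a c → (- s) * a + c ≡ c - s * a
    rearrange = solve-∀ ℚ-ring
    distrib : ∀ y a b → y * a - y * b ≡ y * (a - b)
    distrib = solve-∀ ℚ-ring

LinIndep⇒nonzero : ∀ {n k} (u : Fin k → Point n) → LinIndep u → ∀ l → ¬ (∀ t → u l t ≡ 0ℚ)
LinIndep⇒nonzero u u-indep l ul≡0 = ℚ.1≢0 (trans (sym (basis-self l)) (u-indep (basis l) vanishes l))
  where
  vanishes : ∀ t → combination (basis l) u t ≡ 0ℚ
  vanishes t = trans (∑-basis l (λ l′ → u l′ t)) (ul≡0 t)

dot-const⇒dot-differences≡0 : ∀ {n k} (h : Point n) (v : Fin (suc k) → Point n) →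
  (∀ s → dot h (v s) ≡ dot h (v zero)) → ∀ l → dot h (differences v l) ≡ 0ℚ
dot-const⇒dot-differences≡0 h v h-const l =
  trans (dot--ᵥʳ h (v (suc l)) (v zero))
        (trans (cong (_- dot h (v zero)) (h-const (suc l))) (ℚ.+-inverseʳ (dot h (v zero))))

dot-differences≡0⇒dot-const : ∀ {n k} (h : Point n) (v : Fin (suc k) → Point n) →
  (∀ l → dot h (differences v l) ≡ 0ℚ) → ∀ s → dot h (v s) ≡ dot h (v zero)
dot-differences≡0⇒dot-const h v h⊥ zero    = refl
dot-differences≡0⇒dot-const h v h⊥ (suc l) =
  p-q≡0⇒p≡q (trans (sym (dot--ᵥʳ h (v (suc l)) (v zero))) (h⊥ l))

AffIndep-single : ∀ {n} (x : Point n) → AffIndep (λ (_ : Fin 1) → x)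
AffIndep-single x μ ∑μ≡0 _ zero = trans (sym (ℚ.+-identityʳ (μ zero))) ∑μ≡0

-- Gaussian elimination

InSpan : ∀ {n j} → (Fin j → Point n) → Point n → Set
InSpan {j = j} u x = Σ (Fin j → ℚ) λ β → ∀ t → combination β u t ≡ x t

Separated : ∀ {n j} → (Fin j → Point n) → Point n → Set
Separated {n} u x = Σ (Point n) λ h → (∀ l → dot h (u l) ≡ 0ℚ) × dot h x ≢ 0ℚ

module Pivot {n j} (u : Fin (suc j) → Point n) (t₀ : Fin n) (pivot≢0 : u zero t₀ ≢ 0ℚ) where

  a = u zero

  coeff : Point n → ℚ
  coeff v = v t₀ * a t₀ ⁻¹

  reduce : Point n → Point n
  reduce v = v -ᵥ coeff v *ᵥ a

  reduce-pivot : ∀ t → reduce a t ≡ 0ℚ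
  reduce-pivot t = begin
    a t - (a t₀ * a t₀ ⁻¹) * a t  ≡⟨ cong (λ c → a t - c * a t) (p*p⁻¹≡1 pivot≢0) ⟩
    a t - 1ℚ * a t                ≡⟨ cancel (a t) ⟩
    0ℚ                            ∎
    where
    open ≡-Reasoning
    cancel : ∀ x → x - 1ℚ * x ≡ 0ℚ
    cancel = solve-∀ ℚ-ring

  pullback : Point n → Point n
  pullback h = h -ᵥ (dot h a * a t₀ ⁻¹) *ᵥ basis t₀

  dot-pullback : ∀ h v → dot (pullback h) v ≡ dot h (reduce v)
  dot-pullback h v = begin
    dot (pullback h) v
      ≡⟨ dot--ᵥˡ h _ v ⟩
    dot h v - dot ((dot h a * a t₀ ⁻¹) *ᵥ basis t₀) v
      ≡⟨ cong (λ z → dot h v - z) (dot-*ᵥˡ (dot h a * a t₀ ⁻¹) (basis t₀) v) ⟩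
    dot h v - (dot h a * a t₀ ⁻¹) * dot (basis t₀) v
      ≡⟨ cong (λ c → dot h v - (dot h a * a t₀ ⁻¹) * c) (∑-basis t₀ v) ⟩
    dot h v - (dot h a * a t₀ ⁻¹) * v t₀
      ≡⟨ cong (λ z → dot h v - z) (rearrange (dot h a) (a t₀ ⁻¹) (v t₀)) ⟩
    dot h v - coeff v * dot h a
      ≡⟨ cong (λ z → dot h v - z) (dot-*ᵥʳ (coeff v) h a) ⟨
    dot h v - dot h (coeff v *ᵥ a)
      ≡⟨ dot--ᵥʳ h v _ ⟨
    dot h (reduce v) ∎
    where
    open ≡-Reasoning
    rearrange : ∀ x i y → (x * i) * y ≡ (y * i) * x
    rearrange = solve-∀ ℚ-ring

  InSpan-reduced : ∀ x → InSpan (λ l → reduce (u (suc l))) (reduce x) → InSpan u x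
  InSpan-reduced x (β , β-spans) = (coeff x - S) ∷ β , spans
    where
    c = coeff
    S = ∑ (λ l → β l * c (u (suc l)))
    spans : ∀ t → (c x - S) * a t + combination β (λ l → u (suc l)) t ≡ x t
    spans t = begin
      (c x - S) * a t + C
        ≡⟨ regroup (c x) S (a t) C ⟩
      (C - S * a t) + c x * a t
        ≡⟨ cong (λ z → (C - z) + c x * a t) (∑-*ʳ (a t) (λ l → β l * c (u (suc l)))) ⟨
      (C - ∑ (λ l → (β l * c (u (suc l))) * a t)) + c x * a t
        ≡⟨ cong (_+ c x * a t) (∑-- (λ l → β l * u (suc l) t) (λ l → (β l * c (u (suc l))) * a t)) ⟨
      ∑ (λ l → β l * u (suc l) t - (β l * c (u (suc l))) * a t) + c x * a t
        ≡⟨ cong (_+ c x * a t) (∑-cong (λ l → distrib (β l) (u (suc l) t) (c (u (suc l))) (a t))) ⟩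
      combination β (λ l → reduce (u (suc l))) t + c x * a t
        ≡⟨ cong (_+ c x * a t) (β-spans t) ⟩
      (x t - c x * a t) + c x * a t
        ≡⟨ cancel (x t) (c x * a t) ⟩
      x t ∎
      where
      open ≡-Reasoning
      C = combination β (λ l → u (suc l)) t
      regroup : ∀ cx S a C → (cx - S) * a + C ≡ (C - S * a) + cx * a
      regroup = solve-∀ ℚ-ring
      distrib : ∀ β v c a → β * v - (β * c) * a ≡ β * (v - c * a)
      distrib = solve-∀ ℚ-ring
      cancel : ∀ x y → (x - y) + y ≡ x
      cancel = solve-∀ ℚ-ring

  Separated-reduced : ∀ x → Separated (λ l → reduce (u (suc l))) (reduce x) → Separated u x
  Separated-reduced x (h , h⊥u , hx≢0) =
    pullback h , ⊥u , λ eq → hx≢0 (trans (sym (dot-pullback h x)) eq)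
    where
    ⊥u : ∀ l → dot (pullback h) (u l) ≡ 0ℚ
    ⊥u zero    = trans (dot-pullback h a) (dot-zeroʳ h reduce-pivot)
    ⊥u (suc l) = trans (dot-pullback h (u (suc l))) (h⊥u l)

span-or-separated : ∀ {n j} (u : Fin j → Point n) (x : Point n) → InSpan u x ⊎ Separated u x
span-or-separated {n} {zero} u x with Fin.all? (λ t → x t ℚ.≟ 0ℚ)
... | yes x≡0 = inj₁ ((λ ()) , λ t → sym (x≡0 t))
... | no  x≢0 = inj₂ (x , (λ ()) , 0<p⇒p≢0 (dot-self-pos x x≢0))
span-or-separated {n} {suc j} u x with Fin.any? (λ t → ¬? (u zero t ℚ.≟ 0ℚ))
... | yes (t₀ , pivot≢0) =
  Sum.map (InSpan-reduced x) (Separated-reduced x)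
    (span-or-separated (λ l → reduce (u (suc l))) (reduce x))
  where open Pivot u t₀ pivot≢0
... | no no-pivot = Sum.map prepend-zero extend (span-or-separated (λ l → u (suc l)) x)
  where
  u₀≡0 : ∀ t → u zero t ≡ 0ℚ
  u₀≡0 t with u zero t ℚ.≟ 0ℚ
  ... | yes u₀t≡0 = u₀t≡0
  ... | no  u₀t≢0 = contradiction (t , u₀t≢0) no-pivot
  prepend-zero : InSpan (λ l → u (suc l)) x → InSpan u x
  prepend-zero (β , β-spans) = 0ℚ ∷ β , λ t →
    trans (cong (_+ combination β (λ l → u (suc l)) t) (ℚ.*-zeroˡ (u zero t)))
          (trans (ℚ.+-identityˡ _) (β-spans t))
  extend : Separated (λ l → u (suc l)) x → Separated u x
  extend (h , h⊥u , hx≢0) = h , (λ { zero → dot-zeroʳ h u₀≡0 ; (suc l) → h⊥u l }) , hx≢0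

NonzeroOrthogonal : ∀ {i k} → (Fin k → Point i) → Set
NonzeroOrthogonal {i} A = Σ (Point i) λ y → (∀ r → dot y (A r) ≡ 0ℚ) × ∃ λ l → y l ≢ 0ℚ

module ColumnPivot {i k} (A : Fin (suc k) → Point (suc i)) (r₀ : Fin (suc k))
                   (pivot≢0 : A r₀ zero ≢ 0ℚ) where

  tail : Point (suc i) → Point i
  tail v l = v (suc l)

  c : Fin (suc k) → ℚ
  c r = A r zero * A r₀ zero ⁻¹

  reduced : Fin k → Point i
  reduced r = tail (A (punchIn r₀ r)) -ᵥ c (punchIn r₀ r) *ᵥ tail (A r₀)

  lift : NonzeroOrthogonal reduced → NonzeroOrthogonal A
  lift (y , y⊥ , l₀ , yl₀≢0) = - (S * A r₀ zero ⁻¹) ∷ y , ⊥A , suc l₀ , yl₀≢0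
    where
    S = dot y (tail (A r₀))
    on-tail : ∀ r → dot y (tail (A r)) ≡ c r * S
    on-tail r with r Fin.≟ r₀
    ... | yes refl = sym (trans (cong (_* S) (p*p⁻¹≡1 pivot≢0)) (ℚ.*-identityˡ S))
    ... | no r≢r₀ =
      subst (λ r → dot y (tail (A r)) ≡ c r * S) (Fin.punchIn-punchOut r₀≢r) (p-q≡0⇒p≡q (begin
          dot y (tail (A r′)) - c r′ * S

              ≡⟨ cong (λ z → dot y (tail (A r′)) - z) (dot-*ᵥʳ (c r′) y (tail (A r₀))) ⟨
          dot y (tail (A r′)) - dot y (c r′ *ᵥ tail (A r₀))

              ≡⟨ dot--ᵥʳ y _ _ ⟨
          dot y (reduced (punchOut r₀≢r))

              ≡⟨ y⊥ (punchOut r₀≢r) ⟩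
          0ℚ ∎))
      where
      open ≡-Reasoning
      r₀≢r = λ r₀≡r → r≢r₀ (sym r₀≡r)
      r′ = punchIn r₀ (punchOut r₀≢r)
    ⊥A : ∀ r → - (S * A r₀ zero ⁻¹) * A r zero + dot y (tail (A r)) ≡ 0ℚ
    ⊥A r = trans (cong (- (S * A r₀ zero ⁻¹) * A r zero +_) (on-tail r))
                 (cancel S (A r₀ zero ⁻¹) (A r zero))
      where
      cancel : ∀ S p a → - (S * p) * a + (a * p) * S ≡ 0ℚ
      cancel = solve-∀ ℚ-ring

nonzero-orthogonal : ∀ {k i} → k ℕ.< i → (A : Fin k → Point i) → NonzeroOrthogonal A
nonzero-orthogonal {k} {suc i} k<i A with Fin.any? (λ r → ¬? (A r zero ℚ.≟ 0ℚ))
... | no no-pivot = basis zero , ⊥A , zero , λ e → ℚ.1≢0 (trans (sym (basis-self {suc i} zero)) e)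
  where
  ⊥A : ∀ r → dot (basis zero) (A r) ≡ 0ℚ
  ⊥A r with A r zero ℚ.≟ 0ℚ
  ... | yes Ar₀≡0 = trans (∑-basis zero (A r)) Ar₀≡0
  ... | no  Ar₀≢0 = contradiction (r , Ar₀≢0) no-pivot
nonzero-orthogonal {suc k} {suc i} (s≤s k<i) A | yes (r₀ , pivot≢0) =
  lift (nonzero-orthogonal k<i reduced)
  where open ColumnPivot A r₀ pivot≢0

-- Maximisers on finite sets

∀⊎∃ : ∀ {m} {P Q : Fin m → Set} → (∀ w → P w ⊎ Q w) → (∀ w → P w) ⊎ ∃ Q
∀⊎∃ {zero}  P⊎Q = inj₁ (λ ())
∀⊎∃ {suc m} P⊎Q with P⊎Q zero | ∀⊎∃ (λ w → P⊎Q (suc w))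
... | inj₂ Q₀ | _             = inj₂ (zero , Q₀)
... | inj₁ _  | inj₂ (w , Qw) = inj₂ (suc w , Qw)
... | inj₁ P₀ | inj₁ P₊       = inj₁ λ { zero → P₀ ; (suc w) → P₊ w }

Argmax : ∀ {m} → (Fin m → Set) → (Fin m → ℚ) → Fin m → Set
Argmax S f j = S j × (∀ k → S k → f k ≤ f j)

Argmax-value : ∀ {m} {S : Fin m → Set} {f j k} → Argmax S f j → Argmax S f k → f j ≡ f k
Argmax-value (Sj , j-max) (Sk , k-max) = ℚ.≤-antisym (k-max _ Sj) (j-max _ Sk)

argmax : ∀ {m} {S : Fin m → Set} (f : Fin m → ℚ) → Decidable S → ∃ S → ∃ (Argmax S f)
argmax {suc m} {S} f S? (j₀ , Sj₀) with Fin.any? (λ j → S? (suc j))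
... | no none₊ = zero , S₀ j₀ Sj₀ , λ { zero _ → ℚ.≤-refl ; (suc k) Sk → contradiction (k , Sk) none₊ }
  where
  S₀ : ∀ j → S j → S zero
  S₀ zero    Sj = Sj
  S₀ (suc j) Sj = contradiction (j , Sj) none₊
... | yes some₊ with argmax (λ j → f (suc j)) (λ j → S? (suc j)) some₊
...   | j , Sj , j-max with S? zero | f zero ℚ.≤? f (suc j)
...     | no ¬S₀ | _ = suc j , Sj , λ { zero S₀ → contradiction S₀ ¬S₀ ; (suc k) Sk → j-max k Sk }
...     | yes _ | yes f₀≤ = suc j , Sj , λ { zero _ → f₀≤ ; (suc k) Sk → j-max k Sk }
...     | yes S₀ | no f₀≰ = zero , S₀ , λ
  { zero _ → ℚ.≤-refl ; (suc k) Sk → ℚ.≤-trans (j-max k Sk) (ℚ.<⇒≤ (ℚ.≰⇒> f₀≰)) }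

argmin : ∀ {m} {S : Fin m → Set} (f : Fin m → ℚ) → Decidable S → ∃ S →
  Σ (Fin m) λ j → S j × (∀ k → S k → f j ≤ f k)
argmin f S? nonempty with argmax (λ j → - f j) S? nonempty
... | j , Sj , j-max = j , Sj , λ k Sk →
  subst₂ _≤_ (⁻¹-involutive (f j)) (⁻¹-involutive (f k)) (ℚ.neg-antimono-≤ (j-max k Sk))

Argmax-cong : ∀ {m} {S : Fin m → Set} {f g : Fin m → ℚ} → (∀ k → f k ≡ g k) →
  ∀ {j} → Argmax S f j → Argmax S g j
Argmax-cong f≗g (Sj , j-max) = Sj , λ k Sk → subst₂ _≤_ (f≗g k) (f≗g _) (j-max k Sk)

∉Argmax⇒value≢ : ∀ {m} {S : Fin m → Set} {f : Fin m → ℚ} {a w} →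
  Argmax S f a → S w → ¬ Argmax S f w → f w ≢ f a
∉Argmax⇒value≢ {f = f} (_ , a-max) Sw w∉ fw≡fa = w∉ (Sw , λ k Sk → subst (f k ≤_) (sym fw≡fa) (a-max k Sk))

-- Tilting the objective f towards g: for small t > 0 the maximisers of f + t g
-- on S are the maximisers of g among those of f.
module Tilt {m} {S : Fin m → Set} (S? : Decidable S) (f g : Fin m → ℚ) {a : Fin m}
            (a-max : Argmax (Argmax S f) g a) where

  tilted : ℚ → Fin m → ℚ
  tilted t k = f k + t * g k

  Steeper : Fin m → Set
  Steeper k = S k × g a < g k

  Steeper? : Decidable Steeper
  Steeper? k = S? k ×-dec (g a ℚ.<? g k)

  -- the t at which tilted t k catches up with tilted t a
  ratio : Fin m → ℚ
  ratio k = (f a - f k) * (g k - g a) ⁻¹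

  f≤fa : ∀ k → S k → f k ≤ f a
  f≤fa = proj₂ (proj₁ a-max)

  Steeper⇒f<fa : ∀ {k} → Steeper k → f k < f a
  Steeper⇒f<fa {k} (Sk , ga<gk) with f k ℚ.<? f a
  ... | yes fk<fa = fk<fa
  ... | no  fk≮fa = contradiction (proj₂ a-max k (Sk , k-max)) (<⇒≱ ga<gk)
    where
    k-max : ∀ l → S l → f l ≤ f k
    k-max l Sl = ℚ.≤-trans (f≤fa l Sl) (ℚ.≮⇒≥ fk≮fa)

  ratio-pos : ∀ {k} → Steeper k → 0ℚ < ratio k
  ratio-pos steeper@(_ , ga<gk) = *-pos (p<q⇒0<q-p (Steeper⇒f<fa steeper)) (0<p⇒0<p⁻¹ (p<q⇒0<q-p ga<gk))

  gap : ∀ t k → tilted t a - tilted t k ≡ (f a - f k) + t * (g a - g k)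
  gap t k = rearrange (f a) (f k) (g a) (g k) t
    where
    rearrange : ∀ fa fk ga gk t → (fa + t * ga) - (fk + t * gk) ≡ (fa - fk) + t * (ga - gk)
    rearrange = solve-∀ ℚ-ring

  steeper-gap : ∀ t {k} → Steeper k → tilted t a - tilted t k ≡ (ratio k - t) * (g k - g a)
  steeper-gap t {k} (_ , ga<gk) = begin
    tilted t a - tilted t k                        ≡⟨ gap t k ⟩
    (f a - f k) + t * (g a - g k)                  ≡⟨ cong (_+ t * (g a - g k)) ratio-spec ⟨
    ratio k * (g k - g a) + t * (g a - g k)        ≡⟨ factor (ratio k) t (g k) (g a) ⟩
    (ratio k - t) * (g k - g a)                    ∎
    where
    open ≡-Reasoning
    ratio-spec : ratio k * (g k - g a) ≡ f a - f k
    ratio-spec = begin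
      ((f a - f k) * (g k - g a) ⁻¹) * (g k - g a)
        ≡⟨ ℚ.*-assoc (f a - f k) ((g k - g a) ⁻¹) (g k - g a) ⟩
      (f a - f k) * ((g k - g a) ⁻¹ * (g k - g a))
        ≡⟨ cong ((f a - f k) *_) (ℚ.*-comm ((g k - g a) ⁻¹) (g k - g a)) ⟩
      (f a - f k) * ((g k - g a) * (g k - g a) ⁻¹)
        ≡⟨ cong ((f a - f k) *_) (p*p⁻¹≡1 (0<p⇒p≢0 (p<q⇒0<q-p ga<gk))) ⟩
      (f a - f k) * 1ℚ
        ≡⟨ ℚ.*-identityʳ (f a - f k) ⟩
      f a - f k ∎
    factor : ∀ r t gk ga → r * (gk - ga) + t * (ga - gk) ≡ (r - t) * (gk - ga)
    factor = solve-∀ ℚ-ring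

  tilted≤ : ∀ {t} → 0ℚ ≤ t → (∀ k → Steeper k → t ≤ ratio k) → ∀ k → S k → tilted t k ≤ tilted t a
  tilted≤ {t} 0≤t t≤ratio k Sk with g a ℚ.<? g k
  ... | yes ga<gk = 0≤q-p⇒p≤q (subst (0ℚ ≤_) (sym (steeper-gap t (Sk , ga<gk)))
                      (*-nonNeg (p≤q⇒0≤q-p (t≤ratio k (Sk , ga<gk))) (ℚ.<⇒≤ (p<q⇒0<q-p ga<gk))))
  ... | no  ga≮gk = 0≤q-p⇒p≤q (subst (0ℚ ≤_) (sym (gap t k))
                      (ℚ.+-mono-≤ (p≤q⇒0≤q-p (f≤fa k Sk)) (*-nonNeg 0≤t (p≤q⇒0≤q-p (ℚ.≮⇒≥ ga≮gk)))))

  Argmax-tilted : ∀ {t} → 0ℚ ≤ t → (∀ k → Steeper k → t ≤ ratio k) →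
    ∀ j → Argmax (Argmax S f) g j → Argmax S (tilted t) j
  Argmax-tilted {t} 0≤t t≤ratio j j-max = proj₁ (proj₁ j-max) , λ k Sk →
    subst (tilted t k ≤_) (sym level) (tilted≤ 0≤t t≤ratio k Sk)
    where
    level : tilted t j ≡ tilted t a
    level = cong₂ (λ x y → x + t * y) (Argmax-value (proj₁ j-max) (proj₁ a-max))
                                      (Argmax-value j-max a-max)

  slight-slope : Σ ℚ λ t → 0ℚ < t × (∀ k → Steeper k → t < ratio k)
  slight-slope with Fin.any? Steeper?
  ... | no none = 1ℚ , 0<1 , λ k steeper → contradiction (k , steeper) none
  ... | yes some with argmin ratio Steeper? some
  ...   | w , steeper-w , w-min =
    ratio w * ½ , *-pos (ratio-pos steeper-w) 0<½ ,
    λ k steeper-k → ℚ.<-≤-trans (p*½<p (ratio-pos steeper-w)) (w-min k steeper-k)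

  Argmax-tilted⁻¹ : ∀ {t} → 0ℚ < t → (∀ k → Steeper k → t < ratio k) →
    ∀ j → Argmax S (tilted t) j → Argmax (Argmax S f) g j
  Argmax-tilted⁻¹ {t} 0<t t<ratio j (Sj , j-max) with g a ℚ.<? g j
  ... | yes ga<gj = contradiction (j-max a (proj₁ (proj₁ a-max)))
      (<⇒≱ (0<q-p⇒p<q (subst (0ℚ <_) (sym (steeper-gap t (Sj , ga<gj)))
        (*-pos (p<q⇒0<q-p (t<ratio j (Sj , ga<gj))) (p<q⇒0<q-p ga<gj)))))
  ... | no  ga≮gj =
    (Sj , λ k Sk → ℚ.≤-trans (f≤fa k Sk) (proj₁ tight)) ,
    λ k k-max → ℚ.≤-trans (proj₂ a-max k k-max) (proj₂ tight)
    where
    tight = +-*-tight (f≤fa j Sj) (ℚ.≮⇒≥ ga≮gj) 0<t (j-max a (proj₁ (proj₁ a-max)))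

  tilt-slightly : Σ ℚ λ t → 0ℚ < t × (∀ j → Argmax S (tilted t) j → Argmax (Argmax S f) g j)
                                   × (∀ j → Argmax (Argmax S f) g j → Argmax S (tilted t) j)
  tilt-slightly =
    t , 0<t , Argmax-tilted⁻¹ 0<t t<ratio , Argmax-tilted (ℚ.<⇒≤ 0<t) (λ k s → ℚ.<⇒≤ (t<ratio k s))
    where
    t = proj₁ slight-slope
    0<t = proj₁ (proj₂ slight-slope)
    t<ratio = proj₂ (proj₂ slight-slope)

  tilt-until-contact : ∃ Steeper → Σ ℚ λ t → 0ℚ < t × Σ (Fin m) λ w → Steeper w × Argmax S (tilted t) w
                                         × (∀ j → Argmax (Argmax S f) g j → Argmax S (tilted t) j)
  tilt-until-contact some with argmin ratio Steeper? some
  ... | w , steeper-w , w-min =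
    ratio w , ratio-pos steeper-w , w , steeper-w ,
    (proj₁ steeper-w , λ k Sk → subst (tilted (ratio w) k ≤_) contact (tilted≤ 0≤t w-min k Sk)) ,
    Argmax-tilted 0≤t w-min
    where
    0≤t = ℚ.<⇒≤ (ratio-pos steeper-w)
    contact : tilted (ratio w) a ≡ tilted (ratio w) w
    contact = p-q≡0⇒p≡q (trans (steeper-gap (ratio w) steeper-w)
      (trans (cong (_* (g w - g a)) (ℚ.+-inverseʳ (ratio w))) (ℚ.*-zeroˡ (g w - g a))))

-- Faces and facets

Face : ∀ {n m} → (Fin m → Point n) → (Fin m → Set) → Point n → Fin m → Set
Face V S d = Argmax S (λ j → dot d (V j))

FaceVert? : ∀ {n m} (V : Fin m → Point n) (c : Point n) → Decidable (FaceVert V c)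
FaceVert? V c j = Fin.all? (λ k → dot c (V k) ℚ.≤? dot c (V j))

Face? : ∀ {n m} (V : Fin m → Point n) {S : Fin m → Set} → Decidable S →
  (d : Point n) → Decidable (Face V S d)
Face? V S? d j = S? j ×-dec Fin.all? (λ k → S? k →-dec (dot d (V k) ℚ.≤? dot d (V j)))

face-of-face : ∀ {n m} (V : Fin m → Point n) (c d : Point n) → ∃ (Face V (FaceVert V c) d) →
  Σ (Point n) λ c′ → (∀ j → FaceVert V c′ j → Face V (FaceVert V c) d j)
                   × (∀ j → Face V (FaceVert V c) d j → FaceVert V c′ j)
face-of-face V c d (a , a∈F) =
  c +ᵥ t *ᵥ d ,
  (λ j j∈F′ → from-⊤ (only j (Argmax-cong (λ k → dot-tilted c d (V k) t) (tt , λ k _ → j∈F′ k)))) ,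
  (λ j j∈G k → proj₂ (Argmax-cong (λ k → sym (dot-tilted c d (V k) t)) (all j (to-⊤ j∈G))) k tt)
  where
  f g : Fin _ → ℚ
  f j = dot c (V j)
  g j = dot d (V j)
  to-⊤ : ∀ {j} → Argmax (FaceVert V c) g j → Argmax (Argmax (λ _ → ⊤) f) g j
  to-⊤ (j∈F , j-max) = (tt , λ k _ → j∈F k) , λ k k∈F → j-max k (λ l → proj₂ k∈F l tt)
  from-⊤ : ∀ {j} → Argmax (Argmax (λ _ → ⊤) f) g j → Argmax (FaceVert V c) g j
  from-⊤ (j∈F , j-max) = (λ k → proj₂ j∈F k tt) , λ k k∈F → j-max k (tt , λ l _ → k∈F l)
  open Tilt {S = λ _ → ⊤} (λ _ → yes tt) f g (to-⊤ a∈F)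
  t = proj₁ tilt-slightly
  only = proj₁ (proj₂ (proj₂ tilt-slightly))
  all = proj₂ (proj₂ (proj₂ tilt-slightly))

AffIndep-off-face : ∀ {n m k} (V : Fin m → Point n) {S : Fin m → Set} (d : Point n) {w} →
  S w → ¬ Face V S d w → (q : Fin (suc k) → Fin m) → (∀ s → Face V S d (q s)) →
  AffIndep (λ s → V (q s)) → AffIndep (λ s → V ((w ∷ q) s))
AffIndep-off-face V d Sw w∉F q q∈F q-indep =
  AffIndep-∷ (λ s → V (q s)) (V _) d (dot d (V (q zero))) q-indep
    (λ s → Argmax-value (q∈F s) (q∈F zero)) (∉Argmax⇒value≢ (q∈F zero) Sw w∉F)

-- A proper face of S with j + 1 affinely independent vertices q is enlarged either by
-- a vertex of the face off aff q, or, when the face lies in aff q, by rotating it.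
module Facet {n m} (V : Fin m → Point n) {S : Fin m → Set} (S? : Decidable S) {i : ℕ}
  (p : Fin (suc (suc i)) → Fin m) (p∈S : ∀ s → S (p s)) (p-indep : AffIndep (λ s → V (p s))) where

  U : Fin (suc i) → Point n
  U = differences (λ s → V (p s))

  U-indep : LinIndep U
  U-indep = AffIndep⇒LinIndep-differences (λ s → V (p s)) p-indep

  ProperFace : ℕ → Set
  ProperFace j = Σ (Point n) λ d → (∃ λ w → S w × ¬ Face V S d w) × HasAffIndep V (Face V S d) (suc j)

  varies⇒proper : (d : Point n) → ¬ (∀ l → dot d (U l) ≡ 0ℚ) → ∃ λ w → S w × ¬ Face V S d w
  varies⇒proper d d-varies with Fin.any? (λ s → ¬? (Face? V S? d (p s)))
  ... | yes (s , ps∉F) = p s , p∈S s , ps∉F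
  ... | no  none = contradiction (dot-const⇒dot-differences≡0 d (λ s → V (p s)) d-const) d-varies
    where
    d-const : ∀ s → dot d (V (p s)) ≡ dot d (V (p zero))
    d-const s = Argmax-value (p∈F s) (p∈F zero)
      where
      p∈F : ∀ s → Face V S d (p s)
      p∈F s = decidable-stable (Face? V S? d (p s)) (λ ps∉F → none (s , ps∉F))

  initial-face : ProperFace 0
  initial-face = U zero , varies⇒proper (U zero) U₀-varies , (λ _ → a) , (λ _ → a∈F) , AffIndep-single (V a)
    where
    U₀-varies : ¬ (∀ l → dot (U zero) (U l) ≡ 0ℚ)
    U₀-varies ⊥U = 0<p⇒p≢0 (dot-self-pos (U zero) (LinIndep⇒nonzero U U-indep zero)) (⊥U zero)
    a = proj₁ (argmax (λ j → dot (U zero) (V j)) S? (p zero , p∈S zero))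
    a∈F = proj₂ (argmax (λ j → dot (U zero) (V j)) S? (p zero , p∈S zero))

  module Enlarge {j} (j<i : j ℕ.< i) (d : Point n) (q : Fin (suc j) → Fin m)
                 (q∈F : ∀ s → Face V S d (q s)) (q-indep : AffIndep (λ s → V (q s))) where

    F = Face V S d

    D : Fin j → Point n
    D = differences (λ s → V (q s))

    offset : Fin m → Point n
    offset w = V w -ᵥ V (q zero)

    grow : ∃ (λ w → F w × Separated D (offset w)) → HasAffIndep V F (suc (suc j))
    grow (w , w∈F , h , h⊥D , h-offset≢0) =
      w ∷ q , (λ { zero → w∈F ; (suc s) → q∈F s }) ,
      AffIndep-∷ (λ s → V (q s)) (V w) h (dot h (V (q zero))) q-indep
        (dot-differences≡0⇒dot-const h (λ s → V (q s)) h⊥D)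
        (λ hw≡hq₀ → h-offset≢0 (trans (dot--ᵥʳ h (V w) (V (q zero)))
                                 (trans (cong (_- dot h (V (q zero))) hw≡hq₀)
                                        (ℚ.+-inverseʳ (dot h (V (q zero)))))))

    normals : Fin (suc j) → Point n
    normals = d ∷ D

    -- y ⊥ A r says that combination y U is orthogonal to normals r
    A : Fin (suc j) → Point (suc i)
    A r l = dot (U l) (normals r)

    -- e is a direction of aff S orthogonal to d and to aff F, so it is constant on F
    -- but not on S; tilting d towards e brings a new vertex into the face.
    module Rotation (flat : ∀ w → F w → InSpan D (offset w)) (y : Point (suc i))
                    (y⊥A : ∀ r → dot y (A r) ≡ 0ℚ) {l₀} (yl₀≢0 : y l₀ ≢ 0ℚ) where

      e : Point n
      e = combination y U

      e⊥normals : ∀ r → dot e (normals r) ≡ 0ℚ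
      e⊥normals r = trans (dot-combinationˡ y U (normals r)) (y⊥A r)

      e-flat : ∀ w → F w → dot e (V w) ≡ dot e (V (q zero))
      e-flat w w∈F with flat w w∈F
      ... | β , β-spans = p-q≡0⇒p≡q (begin
        dot e (V w) - dot e (V (q zero))
          ≡⟨ dot--ᵥʳ e (V w) (V (q zero)) ⟨
        dot e (offset w)
          ≡⟨ dot-congʳ e β-spans ⟨
        dot e (combination β D)
          ≡⟨ dot-combinationʳ e β D ⟩
        ∑ (λ l → β l * dot e (D l))
          ≡⟨ ∑-zero (λ l → trans (cong (β l *_) (e⊥normals (suc l))) (ℚ.*-zeroʳ (β l))) ⟩
        0ℚ ∎)
        where open ≡-Reasoning

      ⊥U⇒⊥e : ∀ x → (∀ l → dot x (U l) ≡ 0ℚ) → dot x e ≡ 0ℚ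
      ⊥U⇒⊥e x x⊥U = trans (dot-combinationʳ x y U)
        (∑-zero (λ l → trans (cong (y l *_) (x⊥U l)) (ℚ.*-zeroʳ (y l))))

      0<e·e : 0ℚ < dot e e
      0<e·e = dot-self-pos e (λ e≡0 → yl₀≢0 (U-indep y e≡0 l₀))

      e-varies-on-p : ∃ λ s → dot e (V (p s)) ≢ dot e (V (q zero))
      e-varies-on-p with Fin.any? (λ s → ¬? (dot e (V (p s)) ℚ.≟ dot e (V (q zero))))
      ... | yes found = found
      ... | no  none  = contradiction (⊥U⇒⊥e e (dot-const⇒dot-differences≡0 e (λ s → V (p s)) e-const))
                                      (0<p⇒p≢0 0<e·e)
        where
        level : ∀ s → dot e (V (p s)) ≡ dot e (V (q zero))
        level s = decidable-stable (dot e (V (p s)) ℚ.≟ dot e (V (q zero))) (λ ne → none (s , ne))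
        e-const : ∀ s → dot e (V (p s)) ≡ dot e (V (p zero))
        e-const s = trans (level s) (sym (level zero))

      rotate : ∃ (λ w → S w × dot e (V (q zero)) < dot e (V w)) → ProperFace (suc j)
      rotate rising = d′ , varies⇒proper d′ d′-varies , ws ∷ q , ws∷q∈F′ , ws∷q-indep
        where
        f g : Fin m → ℚ
        f k = dot d (V k)
        g k = dot e (V k)
        q₀-max : Argmax F g (q zero)
        q₀-max = q∈F zero , λ k k∈F → ℚ.≤-reflexive (e-flat k k∈F)
        open Tilt S? f g q₀-max
        contact = tilt-until-contact rising
        t = proj₁ contact
        0<t = proj₁ (proj₂ contact)
        ws = proj₁ (proj₂ (proj₂ contact))
        ws-steeper = proj₁ (proj₂ (proj₂ (proj₂ contact)))
        ws-max = proj₁ (proj₂ (proj₂ (proj₂ (proj₂ contact))))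
        F-kept = proj₂ (proj₂ (proj₂ (proj₂ (proj₂ contact))))
        d′ = d +ᵥ t *ᵥ e
        to-F′ : ∀ {k} → Argmax S (tilted t) k → Face V S d′ k
        to-F′ = Argmax-cong (λ k → sym (dot-tilted d e (V k) t))
        ws∷q∈F′ : ∀ s → Face V S d′ ((ws ∷ q) s)
        ws∷q∈F′ zero    = to-F′ ws-max
        ws∷q∈F′ (suc s) = to-F′ (F-kept (q s) (q∈F s , λ k k∈F →
          ℚ.≤-reflexive (trans (e-flat k k∈F) (sym (e-flat (q s) (q∈F s))))))
        ws∷q-indep = AffIndep-off-face V d (proj₁ ws-steeper)
          (λ ws∈F → <⇒≱ (proj₂ ws-steeper) (ℚ.≤-reflexive (e-flat ws ws∈F))) q q∈F q-indep
        d′·e>0 : 0ℚ < dot d′ e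
        d′·e>0 = subst (0ℚ <_) (sym (begin
          dot d′ e
            ≡⟨ dot-tilted d e e t ⟩
          dot d e + t * dot e e
            ≡⟨ cong (_+ t * dot e e) (trans (dot-comm d e) (e⊥normals zero)) ⟩
          0ℚ + t * dot e e
            ≡⟨ ℚ.+-identityˡ (t * dot e e) ⟩
          t * dot e e ∎)) (*-pos 0<t 0<e·e)
          where open ≡-Reasoning
        d′-varies : ¬ (∀ l → dot d′ (U l) ≡ 0ℚ)
        d′-varies d′⊥U = 0<p⇒p≢0 d′·e>0 (⊥U⇒⊥e d′ d′⊥U)

    classify : ∀ w → (¬ F w ⊎ InSpan D (offset w)) ⊎ (F w × Separated D (offset w))
    classify w with Face? V S? d w
    ... | no  w∉F = inj₁ (inj₁ w∉F)
    ... | yes w∈F = Sum.map inj₂ (w∈F ,_) (span-or-separated D (offset w))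

    rotate-about-hull : (∀ w → F w → InSpan D (offset w)) → ProperFace (suc j)
    rotate-about-hull flat = rotate-either (nonzero-orthogonal (s≤s j<i) A)
      where
      rotate-either : NonzeroOrthogonal A → ProperFace (suc j)
      rotate-either (y , y⊥A , l₀ , yl₀≢0) = by-sign (R.e-varies-on-p)
        where
        module R = Rotation flat y y⊥A yl₀≢0
        y⁻ : Point (suc i)
        y⁻ l = - y l
        module R⁻ = Rotation flat y⁻ (λ r → trans (∑-negˡ y (A r)) (cong -_ (y⊥A r)))
                                     (λ y⁻l₀≡0 → yl₀≢0 (ℚ.neg-injective y⁻l₀≡0))
        dot-e⁻ : ∀ x → dot R⁻.e x ≡ - dot R.e x
        dot-e⁻ x = trans (dot-combinationˡ y⁻ U x)
                         (trans (∑-negˡ y (λ l → dot (U l) x)) (cong -_ (sym (dot-combinationˡ y U x))))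
        by-sign : ∃ (λ s → dot R.e (V (p s)) ≢ dot R.e (V (q zero))) → ProperFace (suc j)
        by-sign (s , e-ps≢E) with ℚ.<-cmp (dot R.e (V (q zero))) (dot R.e (V (p s)))
        ... | tri< E<e-ps _ _ = R.rotate (p s , p∈S s , E<e-ps)
        ... | tri≈ _ E≡e-ps _ = contradiction (sym E≡e-ps) e-ps≢E
        ... | tri> _ _ e-ps<E = R⁻.rotate (p s , p∈S s ,
              subst₂ _<_ (sym (dot-e⁻ (V (q zero)))) (sym (dot-e⁻ (V (p s)))) (ℚ.neg-antimono-< e-ps<E))

    enlarged : (∃ λ w → S w × ¬ F w) → ProperFace (suc j)
    enlarged off =
      [ (λ all → rotate-about-hull (λ w w∈F → [ (λ w∉F → contradiction w∈F w∉F) , id ]′ (all w)))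
      , (λ found → d , off , grow found)
      ]′ (∀⊎∃ classify)

  enlarge : ∀ {j} → j ℕ.< i → ProperFace j → ProperFace (suc j)
  enlarge j<i (d , off , q , q∈F , q-indep) = Enlarge.enlarged j<i d q q∈F q-indep off

  proper-face : ∀ j → j ℕ.≤ i → ProperFace j
  proper-face zero    _   = initial-face
  proper-face (suc j) j<i = enlarge j<i (proper-face j (ℕ.<⇒≤ j<i))

  facet : ¬ HasAffIndep V S (suc (suc (suc i))) → Σ (Point n) λ d → AffDim V (Face V S d) i
  facet too-big = maximal (proper-face i ℕ.≤-refl)
    where
    maximal : ProperFace i → Σ (Point n) λ d → AffDim V (Face V S d) i
    maximal (d , (w , Sw , w∉F) , in-face) = d , in-face , λ { (q , q∈F , q-indep) →
      too-big (w ∷ q , (λ { zero → Sw ; (suc s) → proj₁ (q∈F s) }) ,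
               AffIndep-off-face V d Sw w∉F q q∈F q-indep) }

-- Lattice points in dilated affine hulls

MeetsLattice : ∀ {n m} → (Fin m → Point n) → (Fin m → Set) → ℚ → Set
MeetsLattice {n} V S r =
  Σ (Fin n → ℤ) λ z → Σ (Point n) λ y → InAff V S y × (∀ t → ℤtoℚ (z t) ≡ r * y t)

MeetsLattice-mono : ∀ {n m} (V : Fin m → Point n) {S S′ : Fin m → Set} {r} →
  (∀ j → S′ j → S j) → MeetsLattice V S′ r → MeetsLattice V S r
MeetsLattice-mono V S′⊆S (z , y , (λs , outside≡0 , ∑λs≡1 , combination≡y) , z≡ry) =
  z , y , (λs , (λ j j∉S → outside≡0 j (λ j∈S′ → j∉S (S′⊆S j j∈S′))) , ∑λs≡1 , combination≡y) , z≡ry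

∑-affine : ∀ {k} (u v c : ℚ) (f g : Fin k → ℚ) →
  ∑ (λ j → (u * f j + v * g j) * c) ≡ (u * ∑ f + v * ∑ g) * c
∑-affine u v c f g = begin
  ∑ (λ j → (u * f j + v * g j) * c)        ≡⟨ ∑-*ʳ c (λ j → u * f j + v * g j) ⟩
  ∑ (λ j → u * f j + v * g j) * c          ≡⟨ cong (_* c) (∑-+ (λ j → u * f j) (λ j → v * g j)) ⟩
  (∑ (λ j → u * f j) + ∑ (λ j → v * g j)) * c  ≡⟨ cong (_* c) (cong₂ _+_ (∑-*ˡ u f) (∑-*ˡ v g)) ⟩
  (u * ∑ f + v * ∑ g) * c                  ∎
  where open ≡-Reasoning

InAff-combine : ∀ {n m} (V : Fin m → Point n) {S : Fin m → Set} {y y′ : Point n} (u v : ℚ) →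
  u + v ≢ 0ℚ → InAff V S y → InAff V S y′ → InAff V S (λ t → (u * y t + v * y′ t) * (u + v) ⁻¹)
InAff-combine V {y = y} {y′} u v T≢0
  (λ₁ , λ₁-outside , ∑λ₁≡1 , λ₁-combines) (λ₂ , λ₂-outside , ∑λ₂≡1 , λ₂-combines) =
  λt , outside , total , combines
  where
  T = u + v
  λt : Fin _ → ℚ
  λt j = (u * λ₁ j + v * λ₂ j) * T ⁻¹
  outside : ∀ j → ¬ _ → λt j ≡ 0ℚ
  outside j j∉S = trans (cong₂ (λ x w → (u * x + v * w) * T ⁻¹) (λ₁-outside j j∉S) (λ₂-outside j j∉S))
                        (vanish u v (T ⁻¹))
    where
    vanish : ∀ u v i → (u * 0ℚ + v * 0ℚ) * i ≡ 0ℚ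
    vanish = solve-∀ ℚ-ring
  total : ∑ λt ≡ 1ℚ
  total = begin
    ∑ λt
      ≡⟨ ∑-affine u v (T ⁻¹) λ₁ λ₂ ⟩
    (u * ∑ λ₁ + v * ∑ λ₂) * T ⁻¹
      ≡⟨ cong₂ (λ x w → (u * x + v * w) * T ⁻¹) ∑λ₁≡1 ∑λ₂≡1 ⟩
    (u * 1ℚ + v * 1ℚ) * T ⁻¹
      ≡⟨ cong (_* T ⁻¹) (cong₂ _+_ (ℚ.*-identityʳ u) (ℚ.*-identityʳ v)) ⟩
    T * T ⁻¹
      ≡⟨ p*p⁻¹≡1 T≢0 ⟩
    1ℚ ∎
    where open ≡-Reasoning
  combines : ∀ t → ∑ (λ j → λt j * V j t) ≡ (u * y t + v * y′ t) * T ⁻¹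
  combines t = begin
    ∑ (λ j → λt j * V j t)
      ≡⟨ ∑-cong (λ j → regroup u v (λ₁ j) (λ₂ j) (V j t) (T ⁻¹)) ⟩
    ∑ (λ j → (u * (λ₁ j * V j t) + v * (λ₂ j * V j t)) * T ⁻¹)
      ≡⟨ ∑-affine u v (T ⁻¹) (λ j → λ₁ j * V j t) (λ j → λ₂ j * V j t) ⟩
    (u * ∑ (λ j → λ₁ j * V j t) + v * ∑ (λ j → λ₂ j * V j t)) * T ⁻¹
      ≡⟨ cong₂ (λ x w → (u * x + v * w) * T ⁻¹) (λ₁-combines t) (λ₂-combines t) ⟩
    (u * y t + v * y′ t) * T ⁻¹ ∎
    where
    open ≡-Reasoning
    regroup : ∀ u v l₁ l₂ x i → ((u * l₁ + v * l₂) * i) * x ≡ (u * (l₁ * x) + v * (l₂ * x)) * i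
    regroup = solve-∀ ℚ-ring

MeetsLattice-combine : ∀ {n m} (V : Fin m → Point n) {S : Fin m → Set} {r s} (a b : ℤ) →
  MeetsLattice V S r → MeetsLattice V S s → ℤtoℚ a * r + ℤtoℚ b * s ≢ 0ℚ →
  MeetsLattice V S (ℤtoℚ a * r + ℤtoℚ b * s)
MeetsLattice-combine V {r = r} {s} a b (zr , yr , yr∈aff , zr≡r*yr) (zs , ys , ys∈aff , zs≡s*ys) T≢0 =
  (λ t → a ℤ.* zr t ℤ.+ b ℤ.* zs t) , _ , InAff-combine V u v T≢0 yr∈aff ys∈aff , z≡T*y
  where
  u = ℤtoℚ a * r
  v = ℤtoℚ b * s
  T = u + v
  z≡T*y : ∀ t → ℤtoℚ (a ℤ.* zr t ℤ.+ b ℤ.* zs t) ≡ T * ((u * yr t + v * ys t) * T ⁻¹)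
  z≡T*y t = begin
    ℤtoℚ (a ℤ.* zr t ℤ.+ b ℤ.* zs t)
      ≡⟨ ℤtoℚ-+ (a ℤ.* zr t) (b ℤ.* zs t) ⟩
    ℤtoℚ (a ℤ.* zr t) + ℤtoℚ (b ℤ.* zs t)
      ≡⟨ cong₂ _+_ (ℤtoℚ-* a (zr t)) (ℤtoℚ-* b (zs t)) ⟩
    ℤtoℚ a * ℤtoℚ (zr t) + ℤtoℚ b * ℤtoℚ (zs t)
      ≡⟨ cong₂ (λ x w → ℤtoℚ a * x + ℤtoℚ b * w) (zr≡r*yr t) (zs≡s*ys t) ⟩
    ℤtoℚ a * (r * yr t) + ℤtoℚ b * (s * ys t)
      ≡⟨ regroup (ℤtoℚ a) r (yr t) (ℤtoℚ b) s (ys t) ⟩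
    (u * yr t + v * ys t) * 1ℚ
      ≡⟨ cong ((u * yr t + v * ys t) *_) (p*p⁻¹≡1 T≢0) ⟨
    (u * yr t + v * ys t) * (T * T ⁻¹)
      ≡⟨ rotate (u * yr t + v * ys t) T (T ⁻¹) ⟩
    T * ((u * yr t + v * ys t) * T ⁻¹) ∎
    where
    open ≡-Reasoning
    regroup : ∀ a r y b s w → a * (r * y) + b * (s * w) ≡ ((a * r) * y + (b * s) * w) * 1ℚ
    regroup = solve-∀ ℚ-ring
    rotate : ∀ x T i → x * (T * i) ≡ T * (x * i)
    rotate = solve-∀ ℚ-ring

IndexCond-combine : ∀ {n m} (V : Fin m → Point n) {i r s} (a b : ℤ) →
  IndexCond V i r → IndexCond V i s → ℤtoℚ a * r + ℤtoℚ b * s ≢ 0ℚ →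
  IndexCond V i (ℤtoℚ a * r + ℤtoℚ b * s)
IndexCond-combine V {r = r} {s} a b r-ok s-ok T≢0 c F-dim =
  MeetsLattice-combine V {r = r} {s} a b (r-ok c F-dim) (s-ok c F-dim) T≢0

AffDim-cong : ∀ {n m} (V : Fin m → Point n) {S S′ : Fin m → Set} {i} →
  (∀ j → S j → S′ j) → (∀ j → S′ j → S j) → AffDim V S i → AffDim V S′ i
AffDim-cong V S⊆S′ S′⊆S ((q , q∈S , q-indep) , no-larger) =
  (q , (λ s → S⊆S′ _ (q∈S s)) , q-indep) ,
  λ { (q′ , q′∈S′ , q′-indep) → no-larger (q′ , (λ s → S′⊆S _ (q′∈S′ s)) , q′-indep) }

IndexCond-suc : ∀ {n m} (V : Fin m → Point n) {i r} → IndexCond V i r → IndexCond V (suc i) r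
IndexCond-suc V {i} {r} r-ok c ((p , p∈F , p-indep) , no-larger) =
  MeetsLattice-mono V {r = r} (λ j j∈F′ → proj₁ (F′⊆G j j∈F′)) (r-ok c′ (AffDim-cong V G⊆F′ F′⊆G G-dim))
  where
  open Facet V (FaceVert? V c) p p∈F p-indep using (facet)
  d = proj₁ (facet no-larger)
  G-dim = proj₂ (facet no-larger)
  lifted = face-of-face V c d (proj₁ (proj₁ G-dim) zero , proj₁ (proj₂ (proj₁ G-dim)) zero)
  c′ = proj₁ lifted
  F′⊆G = proj₁ (proj₂ lifted)
  G⊆F′ = proj₂ (proj₂ lifted)

lemma2p4 : ∀ (n m : ℕ) (V : Fin m → Point n) (i : ℕ) → 1 ≤ℕ i → i ≤ℕ n →
    ∀ (r s : ℚ) → IsRationalIndex V (pred i) r → IsRationalIndex V i s →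
    Σ ℤ λ k → r ≡ ℤtoℚ k * s
lemma2p4 n m V (suc i) (s≤s z≤n) _ r s (_ , r-ok , _) (0<s , s-ok , s-least) =
  k , p-q≡0⇒p≡q (ℚ.≤-antisym ρ≤0 0≤ρ)
  where
  k = proj₁ (division-with-remainder r 0<s)
  ρ = r - ℤtoℚ k * s
  0≤ρ = proj₁ (proj₂ (division-with-remainder r 0<s))
  ρ<s = proj₂ (proj₂ (division-with-remainder r 0<s))
  ρ-as-combination : ℤtoℚ (ℤ.+ 1) * r + ℤtoℚ (ℤ.- k) * s ≡ ρ
  ρ-as-combination = begin
    ℤtoℚ (ℤ.+ 1) * r + ℤtoℚ (ℤ.- k) * s  ≡⟨ cong₂ _+_ (ℚ.*-identityˡ r) (cong (_* s) (ℤtoℚ-neg k)) ⟩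
    r + (- ℤtoℚ k) * s                 ≡⟨ cong (λ x → r + x) (sym (ℚ.neg-distribˡ-* (ℤtoℚ k) s)) ⟩
    ρ                                  ∎
    where open ≡-Reasoning
  ρ-ok : 0ℚ < ρ → IndexCond V (suc i) ρ
  ρ-ok 0<ρ = subst (IndexCond V (suc i)) ρ-as-combination
    (IndexCond-combine V {suc i} {r} {s} (ℤ.+ 1) (ℤ.- k) (IndexCond-suc V {i} {r} r-ok) s-ok
      (λ combination≡0 → 0<p⇒p≢0 0<ρ (trans (sym ρ-as-combination) combination≡0)))
  ρ≤0 : ρ ≤ 0ℚ
  ρ≤0 = ℚ.≮⇒≥ (λ 0<ρ → <⇒≱ ρ<s (s-least ρ 0<ρ (ρ-ok 0<ρ)))
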